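{- Let $D=(V,A)$ be an instance of any variant of undirected Reachability Graph Realizability other than the variant asking for an arbitrary (multi-)labeling with strict temporal paths; i.e., one asks for an undirected temporal graph that is simple (one label per edge) with strict or non-strict paths, arbitrary with non-strict paths, proper, or happy, whose reachability graph is $D$. If the solid graph of $D$ contains a special bridge edge, then $D$ is a no-instance (not realizable).
   Context: Given a simple directed graph $D=(V,A)$, Reachability Graph Realizability asks whether there is a temporal graph $\mathcal{G}=(G,\lambda)$ (with $\lambda$ assigning to each edge a set of time labels) whose reachability graph is $D$, where $(u,v)\in A$ iff $u\neq v$ and there is a temporal path from $u$ to $v$ (strict: strictly increasing labels; non-strict: non-decreasing labels). A labeling is simple if every edge has a single label, proper if no two adjacent edges share a label, and happy if it is both. A pair $\{u,v\}$ is a solid edge if both $(u,v)$ and $(v,u)$ are in $A$; the solid graph $G$ of $D$ is the undirected graph on $V$ whose edges are the solid edges. For a bridge $e=\{u,v\}$ of the solid graph whose deletion splits it into components $G_u\ni u$ and $G_v\ni v$, $e$ is special if there exist vertices $a$ in $G_u$ and $b$ in $G_v$ with $(a,v)\in A$, $(u,b)\in A$ and $(a,b)\notin A$ (or the same with the roles of $u$ and $v$ exchanged). Known facts: in every frugal realization (one where no edge's label set can be replaced by a smaller set while remaining a realization), every special bridge receives exactly two labels; and for all variants other than arbitrary labelings with strict paths, every solid edge not contained in a triangle receives at most one label in every minimal realization. -}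

module Defs where

open import Data.Nat using (ℕ; _<_; _≤_)
open import Data.Fin using (Fin)
open import Data.List using (List; []; _∷_)
open import Data.List.Membership.Propositional using (_∈_)
open import Data.List.Relation.Unary.Unique.Propositional using (Unique)
open import Data.Product using (Σ; ∃; _×_)
open import Data.Sum using (_⊎_)
open import Data.Unit using (⊤)
open import Relation.Nullary using (¬_)
open import Relation.Binary.PropositionalEquality using (_≡_; _≢_)
open import Relation.Binary.Construct.Closure.ReflexiveTransitive using (Star)

Digraph : ℕ → Set₁
Digraph n = Fin n → Fin n → Set

-- Undirected temporal graphs on Fin n.
-- λ u v is the (finite) set of time labels of the edge {u,v};
-- {u,v} is an edge of the underlying graph iff λ u v is non-empty.

Labeling : ℕ → Set
Labeling n = Fin n → Fin n → List ℕ

WellFormed : ∀ {n} → Labeling n → Set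
WellFormed {n} λ′ = (∀ (u v : Fin n) → λ′ u v ≡ λ′ v u) × (∀ (u : Fin n) → λ′ u u ≡ [])

data Strictness : Set where
  strict nonStrict : Strictness

TimeRel : Strictness → ℕ → ℕ → Set
TimeRel strict    t t′ = t < t′
TimeRel nonStrict t t′ = t ≤ t′

-- Temporal walk from u to v whose first edge is traversed at time t.
data Journey {n} (λ′ : Labeling n) (s : Strictness) : ℕ → Fin n → Fin n → Set where
  last : ∀ {t u v} → t ∈ λ′ u v → Journey λ′ s t u v
  step : ∀ {t t′ u w v} → t ∈ λ′ u w → TimeRel s t t′ →
         Journey λ′ s t′ w v → Journey λ′ s t u v

vertices : ∀ {n λ′ s t u v} → Journey {n} λ′ s t u v → List (Fin n)
vertices {u = u} {v = v} (last _) = u ∷ v ∷ []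
vertices {u = u} (step _ _ j) = u ∷ vertices j

TemporalPath : ∀ {n} → Labeling n → Strictness → Fin n → Fin n → Set
TemporalPath λ′ s u v = Σ ℕ λ t → Σ (Journey λ′ s t u v) λ j → Unique (vertices j)

Realizes : ∀ {n} → Strictness → Labeling n → Digraph n → Set
Realizes {n} s λ′ A = ∀ (u v : Fin n) →
  (A u v → u ≢ v × TemporalPath λ′ s u v) × (u ≢ v × TemporalPath λ′ s u v → A u v)

IsSimple : ∀ {n} → Labeling n → Set
IsSimple {n} λ′ = ∀ (u v : Fin n) (t t′ : ℕ) → t ∈ λ′ u v → t′ ∈ λ′ u v → t ≡ t′

IsProper : ∀ {n} → Labeling n → Set
IsProper {n} λ′ = ∀ (u v w : Fin n) → v ≢ w → ∀ (t : ℕ) → t ∈ λ′ u v → ¬ (t ∈ λ′ u w)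

data LabelClass : Set where
  simple arbitrary proper happy : LabelClass

InClass : ∀ {n} → LabelClass → Labeling n → Set
InClass simple    λ′ = IsSimple λ′
InClass arbitrary λ′ = ⊤
InClass proper    λ′ = IsProper λ′
InClass happy     λ′ = IsSimple λ′ × IsProper λ′

Realizable : ∀ {n} → LabelClass → Strictness → Digraph n → Set
Realizable {n} c s A = Σ (Labeling n) λ λ′ → WellFormed λ′ × InClass c λ′ × Realizes s λ′ A

Solid : ∀ {n} → Digraph n → Fin n → Fin n → Set
Solid A u v = A u v × A v u

SolidWithout : ∀ {n} → Digraph n → Fin n → Fin n → Fin n → Fin n → Set
SolidWithout A u v x y = Solid A x y × ¬ ((x ≡ u × y ≡ v) ⊎ (x ≡ v × y ≡ u))

ConnWithout : ∀ {n} → Digraph n → Fin n → Fin n → Fin n → Fin n → Set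
ConnWithout A u v = Star (SolidWithout A u v)

IsBridge : ∀ {n} → Digraph n → Fin n → Fin n → Set
IsBridge A u v = Solid A u v × ¬ ConnWithout A u v u v

-- a ∈ G_u, b ∈ G_v, (a,v) ∈ A, (u,b) ∈ A, (a,b) ∉ A
SpecialWitness : ∀ {n} → Digraph n → Fin n → Fin n → Set
SpecialWitness {n} A u v = Σ (Fin n) λ a → Σ (Fin n) λ b →
  ConnWithout A u v u a × ConnWithout A u v v b × A a v × A u b × ¬ A a b

IsSpecialBridge : ∀ {n} → Digraph n → Fin n → Fin n → Set
IsSpecialBridge A u v = IsBridge A u v × (SpecialWitness A u v ⊎ SpecialWitness A v u)

-- Let {u,v} be a special bridge with witnesses a ∈ G_u, b ∈ G_v, and take temporal paths
-- P : a ⇝ v and Q : u ⇝ b.  P must enter u from some x ∈ G_u, at time s say, and then cross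
-- uv; Q must start by crossing uv, at time t.  If t may follow s, then P up to u followed by Q
-- is a journey a ⇝ b, so (a,b) ∈ A.  Otherwise t precedes s (for strict paths s = t is
-- excluded: a proper labeling separates xu from uv, and a simple one gives uv only the label
-- that P uses after s), so x ⇝ u ⇝ v and v ⇝ u ⇝ x are both temporal paths: xv is a solid
-- edge joining G_u to v, contradicting that uv is a bridge.
module Submission where

open import Defs
open import Data.Nat using (ℕ; _≤_)
open import Data.Nat.Properties using (≤-refl; ≤-trans; <⇒≤; <-≤-trans; <⇒≢; ≤-total; <-cmp)
open import Data.Fin using (Fin; _≟_)
open import Data.List using ([])
open import Data.List.Membership.Propositional using (_∈_)
open import Data.List.Relation.Unary.Any using (here; there; any?)
open import Data.List.Relation.Unary.All using (All; []; _∷_)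
open import Data.List.Relation.Unary.All.Properties using (¬Any⇒All¬)
open import Data.List.Relation.Unary.AllPairs using ([]; _∷_)
open import Data.List.Relation.Unary.Unique.Propositional using (Unique)
open import Data.Product using (Σ; _×_; _,_; proj₁; proj₂)
open import Data.Sum using (_⊎_; inj₁; inj₂; [_,_])
open import Data.Empty using (⊥-elim)
open import Relation.Nullary using (¬_; yes; no)
open import Relation.Binary using (tri<; tri≈; tri>)
open import Relation.Binary.PropositionalEquality using (_≡_; _≢_; refl; sym; subst)
open import Relation.Binary.Construct.Closure.ReflexiveTransitive
  using (ε; _◅_; _◅◅_; reverse; map)

TimeRel⇒≤ : ∀ st {t t′} → TimeRel st t t′ → t ≤ t′
TimeRel⇒≤ strict    = <⇒≤
TimeRel⇒≤ nonStrict t≤t′ = t≤t′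

TimeRel-≤-trans : ∀ st {t t′ t″} → TimeRel st t t′ → t′ ≤ t″ → TimeRel st t t″
TimeRel-≤-trans strict    = <-≤-trans
TimeRel-≤-trans nonStrict = ≤-trans

module _ {n : ℕ} {A : Digraph n} {u v : Fin n} where

  solidWithout-avoiding-u : ∀ {x y} → Solid A x y → x ≢ u → y ≢ u → SolidWithout A u v x y
  solidWithout-avoiding-u xy x≢u y≢u = xy , λ
    { (inj₁ (x≡u , _)) → x≢u x≡u
    ; (inj₂ (_ , y≡u)) → y≢u y≡u
    }

  solidWithout-avoiding-v : ∀ {x y} → Solid A x y → x ≢ v → y ≢ v → SolidWithout A u v x y
  solidWithout-avoiding-v xy x≢v y≢v = xy , λ
    { (inj₁ (_ , y≡v)) → y≢v y≡v
    ; (inj₂ (x≡v , _)) → x≢v x≡v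
    }

  solidWithout-sym : ∀ {x y} → SolidWithout A u v x y → SolidWithout A u v y x
  solidWithout-sym ((Axy , Ayx) , ¬uv) = (Ayx , Axy) , λ
    { (inj₁ (y≡u , x≡v)) → ¬uv (inj₂ (x≡v , y≡u))
    ; (inj₂ (y≡v , x≡u)) → ¬uv (inj₁ (x≡u , y≡v))
    }

  solidWithout-swap : ∀ {x y} → SolidWithout A v u x y → SolidWithout A u v x y
  solidWithout-swap (xy , ¬vu) = xy , λ
    { (inj₁ uv) → ¬vu (inj₂ uv)
    ; (inj₂ vu) → ¬vu (inj₁ vu)
    }

  connWithout-sym : ∀ {x y} → ConnWithout A u v x y → ConnWithout A u v y x
  connWithout-sym = reverse solidWithout-sym

  isBridge-sym : IsBridge A u v → IsBridge A v u
  isBridge-sym ((Auv , Avu) , ¬conn) =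
    (Avu , Auv) , λ vu → ¬conn (connWithout-sym (map solidWithout-swap vu))

  isBridge⇒≢ : IsBridge A u v → u ≢ v
  isBridge⇒≢ (_ , ¬conn) refl = ¬conn ε

PathAfter : ∀ {n} → Labeling n → Strictness → ℕ → Fin n → Fin n → Set
PathAfter L st t w z = Σ ℕ λ t′ → t ≤ t′ × Σ (Journey L st t′ w z) λ j → Unique (vertices j)

module _ {n : ℕ} {L : Labeling n} {st : Strictness} where

  All-vertices-head : ∀ {P : Fin n → Set} {t w z} (j : Journey L st t w z) →
                      All P (vertices j) → P w
  All-vertices-head (last _)     (pw ∷ _) = pw
  All-vertices-head (step _ _ _) (pw ∷ _) = pw

  path-suffix : ∀ {t w x z} (j : Journey L st t w z) → Unique (vertices j) →
                x ∈ vertices j → x ≢ z → PathAfter L st t x z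
  path-suffix j@(last _)     uniq       (here refl)         _   = _ , ≤-refl , j , uniq
  path-suffix (last _)       _          (there (here refl)) x≢z = ⊥-elim (x≢z refl)
  path-suffix j@(step _ _ _) uniq       (here refl)         _   = _ , ≤-refl , j , uniq
  path-suffix (step _ t<t′ j) (_ ∷ uniq) (there x∈j)        x≢z
    with path-suffix j uniq x∈j x≢z
  ... | t″ , t′≤t″ , p , uniq′ = t″ , ≤-trans (TimeRel⇒≤ st t<t′) t′≤t″ , p , uniq′

  -- If w reappears on the path extracted from the tail, restart from that occurrence.
  journey⇒path : ∀ {t w z} → Journey L st t w z → w ≢ z → PathAfter L st t w z
  journey⇒path (last wz) w≢z = _ , ≤-refl , last wz , (w≢z ∷ []) ∷ [] ∷ []
  journey⇒path {w = w} {z} (step {w = y} wy t<t′ j) w≢z with y ≟ z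
  ... | yes refl = _ , ≤-refl , last wy , (w≢z ∷ []) ∷ [] ∷ []
  ... | no y≢z with journey⇒path j y≢z
  ... | t″ , t′≤t″ , p , uniq with any? (w ≟_) (vertices p)
  ...   | yes w∈p with path-suffix p uniq w∈p w≢z
  ...     | t‴ , t″≤t‴ , p′ , uniq′ =
              t‴ , ≤-trans (TimeRel⇒≤ st t<t′) (≤-trans t′≤t″ t″≤t‴) , p′ , uniq′
  journey⇒path (step wy t<t′ j) _ | no _ | t″ , t′≤t″ , p , uniq | no w∉p =
    _ , ≤-refl , step wy (TimeRel-≤-trans st t<t′ t′≤t″) p , ¬Any⇒All¬ (vertices p) w∉p ∷ uniq

adjacent-labels-≢ : ∀ {n} {L : Labeling n} c → c ≢ arbitrary → InClass c L →
                    ∀ {u v x s τ t} → x ≢ v → s ∈ L u x → τ ∈ L u v → s ≢ τ → t ∈ L u v → s ≢ t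
adjacent-labels-≢ simple    _     simple′      _   _   τ∈uv s≢τ t∈uv s≡t =
  s≢τ (subst (_≡ _) (sym s≡t) (simple′ _ _ _ _ t∈uv τ∈uv))
adjacent-labels-≢ arbitrary c≢arb _            = ⊥-elim (c≢arb refl)
adjacent-labels-≢ proper    _     proper′      x≢v s∈ux _   _   t∈uv refl =
  proper′ _ _ _ x≢v _ s∈ux t∈uv
adjacent-labels-≢ happy     _     (_ , proper′) x≢v s∈ux _   _   t∈uv refl =
  proper′ _ _ _ x≢v _ s∈ux t∈uv

adjacent-labels-comparable :
  ∀ {n} {L : Labeling n} c st → ¬ (c ≡ arbitrary × st ≡ strict) → InClass c L →
  ∀ {u v x s τ t} → x ≢ v → s ∈ L u x → τ ∈ L u v → TimeRel st s τ → t ∈ L u v →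
  TimeRel st s t ⊎ TimeRel st t s
adjacent-labels-comparable c nonStrict _ _ {s = s} {t = t} _ _ _ _ _ = ≤-total s t
adjacent-labels-comparable c strict ¬arb-strict inC {s = s} {t = t} x≢v s∈ux τ∈uv s<τ t∈uv
  with <-cmp s t
... | tri< s<t _ _ = inj₁ s<t
... | tri> _ _ t<s = inj₂ t<s
... | tri≈ _ s≡t _ = ⊥-elim
  (adjacent-labels-≢ c (λ c≡arb → ¬arb-strict (c≡arb , refl)) inC x≢v s∈ux τ∈uv (<⇒≢ s<τ) t∈uv s≡t)

module Realization {n : ℕ} {A : Digraph n} {L : Labeling n} {st : Strictness}
                   (wf : WellFormed L) (R : Realizes st L A) where

  label-sym : ∀ {t x y} → t ∈ L x y → t ∈ L y x
  label-sym {x = x} {y} = subst (_ ∈_) (proj₁ wf x y)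

  label⇒≢ : ∀ {t x y} → t ∈ L x y → x ≢ y
  label⇒≢ {x = x} t∈xx refl with L x x | proj₂ wf x
  label⇒≢ () refl | .[] | refl

  arc⇒path : ∀ {x y} → A x y → TemporalPath L st x y
  arc⇒path Axy = proj₂ (proj₁ (R _ _) Axy)

  journey⇒arc : ∀ {t x y} → Journey L st t x y → x ≢ y → A x y
  journey⇒arc j x≢y with journey⇒path j x≢y
  ... | t′ , _ , p , uniq = proj₂ (R _ _) (x≢y , t′ , p , uniq)

  label⇒solid : ∀ {t x y} → t ∈ L x y → Solid A x y
  label⇒solid xy = journey⇒arc (last xy) (label⇒≢ xy)
                 , journey⇒arc (last (label-sym xy)) (label⇒≢ (label-sym xy))

  solid-detour : ∀ {x u v s τ t} → x ≢ v → s ∈ L x u → τ ∈ L u v → t ∈ L u v →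
                 TimeRel st s τ → TimeRel st t s → Solid A x v
  solid-detour x≢v s∈xu τ∈uv t∈uv s<τ t<s =
      journey⇒arc (step s∈xu s<τ (last τ∈uv)) x≢v
    , journey⇒arc (step (label-sym t∈uv) t<s (last (label-sym s∈xu))) (λ v≡x → x≢v (sym v≡x))

  module Bridge {u v : Fin n} (bridge : IsBridge A u v) where

    private
      G_u : Fin n → Set
      G_u = ConnWithout A u v u

      v∉G_u : ¬ G_u v
      v∉G_u = proj₂ bridge

      u≢v : u ≢ v
      u≢v = isBridge⇒≢ bridge

    G_u-step : ∀ {t w y} → G_u w → t ∈ L w y → w ≢ u → y ≢ u → G_u y
    G_u-step w∈G wy w≢u y≢u = w∈G ◅◅ (solidWithout-avoiding-u {A = A} (label⇒solid wy) w≢u y≢u ◅ ε)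

    journey-avoiding-u-stays : ∀ {t w z} (j : Journey L st t w z) → All (u ≢_) (vertices j) →
                               G_u w → G_u z
    journey-avoiding-u-stays (last wz) (u≢w ∷ u≢z ∷ []) w∈G =
      G_u-step w∈G wz (λ w≡u → u≢w (sym w≡u)) (λ z≡u → u≢z (sym z≡u))
    journey-avoiding-u-stays (step wy _ j) (u≢w ∷ u∉j) w∈G =
      journey-avoiding-u-stays j u∉j
        (G_u-step w∈G wy (λ w≡u → u≢w (sym w≡u)) (λ y≡u → All-vertices-head j u∉j (sym y≡u)))

    path-leaving-G_u-starts-on-bridge : ∀ {t z} (j : Journey L st t u z) → Unique (vertices j) →
                                        ¬ G_u z → t ∈ L u v
    path-leaving-G_u-starts-on-bridge {z = z} (last uz) _ z∉G with z ≟ v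
    ... | yes refl = uz
    ... | no z≢v   = ⊥-elim (z∉G (solidWithout-avoiding-v {A = A} (label⇒solid uz) u≢v z≢v ◅ ε))
    path-leaving-G_u-starts-on-bridge (step {w = y} uy _ j) (u∉j ∷ uniq) z∉G with y ≟ v
    ... | yes refl = uy
    ... | no y≢v   = ⊥-elim (z∉G (journey-avoiding-u-stays j u∉j
                       (solidWithout-avoiding-v {A = A} (label⇒solid uy) u≢v y≢v ◅ ε)))

    -- A journey w ⇝ u whose last edge xu is traversed at time s, kept in continuation form so
    -- that any journey leaving u after s can be appended to it.
    record EntryToU (t : ℕ) (w : Fin n) : Set where
      field
        {x}     : Fin n
        {s τ}   : ℕ
        x∈G_u   : G_u x
        s∈xu    : s ∈ L x u
        τ∈uv    : τ ∈ L u v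
        s<τ     : TimeRel st s τ
        prepend : ∀ {t′ z} → TimeRel st s t′ → Journey L st t′ u z → Journey L st t w z

      x≢v : x ≢ v
      x≢v x≡v = v∉G_u (subst G_u x≡v x∈G_u)

    path-to-v-enters-u : ∀ {t w} (j : Journey L st t w v) → Unique (vertices j) →
                         G_u w → w ≢ u → EntryToU t w
    path-to-v-enters-u (last wv) _ w∈G w≢u =
      ⊥-elim (v∉G_u (G_u-step w∈G wv w≢u (λ v≡u → u≢v (sym v≡u))))
    path-to-v-enters-u (step {w = y} wy w<t′ j) (_ ∷ uniq) w∈G w≢u with y ≟ u
    ... | yes refl = record
      { x∈G_u   = w∈G
      ; s∈xu    = wy
      ; τ∈uv    = path-leaving-G_u-starts-on-bridge j uniq v∉G_u
      ; s<τ     = w<t′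
      ; prepend = λ w<t″ k → step wy w<t″ k
      }
    ... | no y≢u = record
      { x∈G_u   = x∈G_u
      ; s∈xu    = s∈xu
      ; τ∈uv    = τ∈uv
      ; s<τ     = s<τ
      ; prepend = λ s<t″ k → step wy w<t′ (prepend s<t″ k)
      }
      where open EntryToU (path-to-v-enters-u j uniq (G_u-step w∈G wy w≢u y≢u) y≢u)

    entry-then-bridge⇒arc : ∀ c → ¬ (c ≡ arbitrary × st ≡ strict) → InClass c L →
                            ∀ {t t′ w z} → EntryToU t w → Journey L st t′ u z → t′ ∈ L u v →
                            w ≢ z → A w z
    entry-then-bridge⇒arc c ¬arb-strict inC e q t′∈uv w≢z
      with adjacent-labels-comparable c st ¬arb-strict inC x≢v (label-sym s∈xu) τ∈uv s<τ t′∈uv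
      where open EntryToU e
    ... | inj₁ s<t′ = journey⇒arc (EntryToU.prepend e s<t′ q) w≢z
    ... | inj₂ t′<s = ⊥-elim (v∉G_u (x∈G_u ◅◅ (xv−uv ◅ ε)))
      where
        open EntryToU e
        xv−uv : SolidWithout A u v x v
        xv−uv = solidWithout-avoiding-u {A = A} (solid-detour x≢v s∈xu τ∈uv t′∈uv s<τ t′<s)
                  (label⇒≢ s∈xu) (λ v≡u → u≢v (sym v≡u))

    special-witness⇒⊥ : ∀ c → ¬ (c ≡ arbitrary × st ≡ strict) → InClass c L →
                        ¬ SpecialWitness A u v
    special-witness⇒⊥ c ¬arb-strict inC (a , b , a∈G_u , b∈G_v , Aav , Aub , ¬Aab) with a ≟ u
    ... | yes refl = ¬Aab Aub
    ... | no a≢u with arc⇒path Aav | arc⇒path Aub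
    ... | _ , p , uniq-p | _ , q , uniq-q =
      ¬Aab (entry-then-bridge⇒arc c ¬arb-strict inC (path-to-v-enters-u p uniq-p a∈G_u a≢u) q
              (path-leaving-G_u-starts-on-bridge q uniq-q b∉G_u) a≢b)
      where
        b∉G_u : ¬ G_u b
        b∉G_u b∈G_u = v∉G_u (b∈G_u ◅◅ connWithout-sym b∈G_v)
        a≢b : a ≢ b
        a≢b refl = b∉G_u a∈G_u

corollary8 : (n : ℕ) (A : Digraph n) (c : LabelClass) (s : Strictness) →
    ¬ (c ≡ arbitrary × s ≡ strict) →
    (u v : Fin n) → IsSpecialBridge A u v → ¬ Realizable c s A
corollary8 n A c s ¬arb-strict u v (bridge , witness) (L , wf , inC , R) =
  [ Bridge.special-witness⇒⊥ bridge c ¬arb-strict inC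
  , Bridge.special-witness⇒⊥ (isBridge-sym bridge) c ¬arb-strict inC
  ] witness
  where open Realization wf R
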